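{- Let $\sigma, \tau \in S_n$ be such that the classes $[\tau]$ and $[\sigma]$ are incomparable with respect to $\leq_{[\mathrm{c}]}$. Then there exist positive definite matrices $A, A' \in M_n(\mathbb{R})$ such that $0 < A_\sigma < A_\tau$ and $0 < A'_\tau < A'_\sigma$.
   Context: A real matrix $A$ is positive definite if it is symmetric and $z^\top A z > 0$ for all nonzero $z \in \mathbb{R}^n$. For $A=(a_{ij})$ and $\sigma \in S_n$, $A_\sigma = \prod_{k=1}^n a_{k,\sigma(k)}$. For $\sigma \in S_n$ and $\ell \ge 2$, $C_\ell(\sigma)$ is the set of $\ell$-cycles of $\sigma$; $\tau \leq_{\mathrm{c}} \sigma$ iff $C_k(\tau) \subseteq C_k(\sigma)$ for all $k \ge 2$. The equivalence relation $\sim_{\mathrm{c}}$: $\sigma \sim_{\mathrm{c}} \tau$ if each cycle of $\sigma$ (fixed points included as 1-cycles) is equal to or the inverse of a cycle of $\tau$, and vice versa; $[\sigma]$ is the class of $\sigma$. $[\tau] \leq_{[\mathrm{c}]} [\sigma]$ iff there exist $\tau' \in [\tau]$, $\sigma' \in [\sigma]$ with $\tau' \leq_{\mathrm{c}} \sigma'$. -}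

module Defs where

open import Data.Nat using (ℕ; zero; suc)
open import Data.Fin using (Fin)
open import Data.Fin.Permutation using (Permutation′; _⟨$⟩ʳ_; _⟨$⟩ˡ_)
open import Data.Rational using (ℚ; 0ℚ; 1ℚ; _+_; _*_; _<_)
open import Data.Product using (Σ; ∃; _×_; _,_)
open import Data.Sum using (_⊎_)
open import Relation.Binary.PropositionalEquality using (_≡_; _≢_)
open import Relation.Nullary using (¬_)

sumFin : ∀ {n} → (Fin n → ℚ) → ℚ
sumFin {zero}  f = 0ℚ
sumFin {suc n} f = f Fin.zero + sumFin (λ i → f (Fin.suc i))

prodFin : ∀ {n} → (Fin n → ℚ) → ℚ
prodFin {zero}  f = 1ℚ
prodFin {suc n} f = f Fin.zero * prodFin (λ i → f (Fin.suc i))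

Matrix : ℕ → Set
Matrix n = Fin n → Fin n → ℚ

Symmetric : ∀ {n} → Matrix n → Set
Symmetric A = ∀ i j → A i j ≡ A j i

quadForm : ∀ {n} → Matrix n → (Fin n → ℚ) → ℚ
quadForm A z = sumFin (λ i → sumFin (λ j → z i * A i j * z j))

NonZeroVec : ∀ {n} → (Fin n → ℚ) → Set
NonZeroVec z = ∃ λ i → z i ≢ 0ℚ

PositiveDefinite : ∀ {n} → Matrix n → Set
PositiveDefinite A = Symmetric A × (∀ z → NonZeroVec z → 0ℚ < quadForm A z)

permProd : ∀ {n} → Matrix n → Permutation′ n → ℚ
permProd A σ = prodFin (λ k → A k (σ ⟨$⟩ʳ k))

iter : ∀ {n} → (Fin n → Fin n) → ℕ → Fin n → Fin n
iter f zero    x = x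
iter f (suc k) x = f (iter f k x)

cycleSeq : ∀ {n} → Permutation′ n → Fin n → ℕ → Fin n
cycleSeq σ x k = iter (σ ⟨$⟩ʳ_) k x

invCycleSeq : ∀ {n} → Permutation′ n → Fin n → ℕ → Fin n
invCycleSeq σ x k = iter (σ ⟨$⟩ˡ_) k x

-- τ ≤c σ : every cycle of τ of length ≥ 2 (i.e. the cycle through a
-- non-fixed point x) is a cycle of σ (the same cyclic sequence through x).
_≤c_ : ∀ {n} → Permutation′ n → Permutation′ n → Set
τ ≤c σ = ∀ x → τ ⟨$⟩ʳ x ≢ x → ∀ k → cycleSeq τ x k ≡ cycleSeq σ x k

-- Each cycle of σ (fixed points included) equals a cycle of τ or its inverse.
CyclesIn : ∀ {n} → Permutation′ n → Permutation′ n → Set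
CyclesIn σ τ = ∀ x → (∀ k → cycleSeq σ x k ≡ cycleSeq τ x k)
                   ⊎ (∀ k → cycleSeq σ x k ≡ invCycleSeq τ x k)

_∼c_ : ∀ {n} → Permutation′ n → Permutation′ n → Set
σ ∼c τ = CyclesIn σ τ × CyclesIn τ σ

-- [τ] ≤[c] [σ]  (stated on representatives)
_≤[c]_ : ∀ {n} → Permutation′ n → Permutation′ n → Set
τ ≤[c] σ = ∃ λ τ' → ∃ λ σ' → (τ' ∼c τ) × (σ' ∼c σ) × (τ' ≤c σ')

Incomparable : ∀ {n} → Permutation′ n → Permutation′ n → Set
Incomparable σ τ = ¬ (τ ≤[c] σ) × ¬ (σ ≤[c] τ)

{-# OPTIONS --safe #-}
module Submission where

-- Call an arc a ↦ b = σ a (a ≠ b) of σ separating for τ if τ b ≠ a and, in case τ a = b,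
-- also σ b = a.  Without separating arcs, τ agrees with σ or with σ⁻¹ along every
-- non-trivial cycle of σ and preserves the support of σ; restricting τ to that support
-- gives a permutation whose cycles are those of σ up to orientation and are also cycles
-- of τ, so σ ≤[c] τ.
--
-- Given a separating arc a ↦ b, take M = I + J + ε (eₐ - e_b)(eₐ - e_b)ᵀ with ε = 1 - d
-- and d = 1/2ⁿ⁺¹.  It is positive definite, M_ab = M_ba = d, all its other entries are
-- at least 1, those outside rows a and b are at most 2, and M_bj ≤ 1 for j ≠ b.  Hence
-- M_σ ≤ d·2ⁿ < 1 ≤ M_τ if τ a ≠ b, and M_σ ≤ d²·2ⁿ < d ≤ M_τ if τ a = b (then σ b = a).

open import Defs
open import Algebra.Bundles using (Ring; CommutativeMonoid)
open import Data.Bool using (if_then_else_)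
open import Data.Fin using (Fin; zero; suc)
open import Data.Fin.Permutation using (Permutation′; _⟨$⟩ʳ_; _⟨$⟩ˡ_; permutation; inverseˡ; inverseʳ)
open import Data.Fin.Properties using (_≟_; any?)
open import Data.Nat using (ℕ; zero; suc)
open import Data.Product using (∃; _×_; _,_; proj₁; proj₂)
open import Data.Rational using (ℚ; 0ℚ; 1ℚ; ½; _+_; _*_; _-_; -_; _≤_; _<_; 1/_; _≤?_; _<?_; NonZero; Positive; positive; negative; nonNegative)
open import Data.Rational.Properties hiding (_≟_)
import Data.Rational.Properties as ℚ
open import Data.Rational.Solver using (module +-*-Solver)
open import Data.Sum using (_⊎_; inj₁; inj₂; [_,_])
import Data.Sum as Sum
open import Data.Vec.Functional using (updateAt)
open import Data.Vec.Functional.Properties using (updateAt-updates; updateAt-minimal)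
open import Function using (_∘_; const; Injection)
open import Function.Properties.Inverse using (↔⇒↣)
open import Level using (Level)
open import Relation.Binary.Definitions using (tri<; tri≈; tri>)
open import Relation.Binary.PropositionalEquality using (_≡_; _≢_; refl; sym; trans; cong; cong₂; subst; module ≡-Reasoning)
open import Relation.Nullary using (¬_; does; yes; no; ¬?; _×-dec_; _→-dec_)
open import Relation.Nullary.Decidable using (dec-true; dec-false; from-yes; decidable-stable)
open import Relation.Nullary.Negation using (contradiction)
open import Relation.Unary using (Pred; Decidable)

open import Algebra.Properties.Semiring.Sum (Ring.semiring +-*-ring)
  using (sum; sum-syntax; sum-cong-≗; ∑-distrib-+; *-distribˡ-sum; *-distribʳ-sum; sum-replicate-zero)
open import Algebra.Properties.CommutativeSemigroup (CommutativeMonoid.commutativeSemigroup *-1-commutativeMonoid)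
  using (x∙yz≈y∙xz)

private
  variable
    ℓ : Level
    n : ℕ

-- Orbits and restrictions of permutations

iter-preserves : (f : Fin n → Fin n) {P : Pred (Fin n) ℓ} →
                 (∀ {y} → P y → P (f y)) → ∀ {x} → P x → ∀ k → P (iter f k x)
iter-preserves f P-closed Px zero    = Px
iter-preserves f {P} P-closed Px (suc k) = P-closed (iter-preserves f {P = P} P-closed Px k)

iter-agree : (f g : Fin n → Fin n) {P : Pred (Fin n) ℓ} →
             (∀ {y} → P y → P (f y)) → (∀ {y} → P y → f y ≡ g y) →
             ∀ {x} → P x → ∀ k → iter f k x ≡ iter g k x
iter-agree f g P-closed f≡g Px zero    = refl
iter-agree f g {P} P-closed f≡g Px (suc k) =
  trans (f≡g (iter-preserves f {P = P} P-closed Px k)) (cong g (iter-agree f g P-closed f≡g Px k))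

∼c-refl : (π : Permutation′ n) → π ∼c π
∼c-refl π = (λ _ → inj₁ λ _ → refl) , (λ _ → inj₁ λ _ → refl)

⟨$⟩ʳ-injective : (π : Permutation′ n) {x y : Fin n} → π ⟨$⟩ʳ x ≡ π ⟨$⟩ʳ y → x ≡ y
⟨$⟩ʳ-injective π = Injection.injective (↔⇒↣ π)

module Restriction (π : Permutation′ n) {S : Pred (Fin n) ℓ} (S? : Decidable S)
       (π-closed : ∀ {y} → S y → S (π ⟨$⟩ʳ y)) (π⁻¹-closed : ∀ {y} → S y → S (π ⟨$⟩ˡ y)) where

  on-S : (Fin n → Fin n) → Fin n → Fin n
  on-S h y with S? y
  ... | yes _ = h y
  ... | no  _ = y

  on-S-inside : (h : Fin n → Fin n) → ∀ {y} → S y → on-S h y ≡ h y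
  on-S-inside h {y} Sy with S? y
  ... | yes _  = refl
  ... | no ¬Sy = contradiction Sy ¬Sy

  on-S-outside : (h : Fin n → Fin n) → ∀ {y} → ¬ S y → on-S h y ≡ y
  on-S-outside h {y} ¬Sy with S? y
  ... | yes Sy = contradiction Sy ¬Sy
  ... | no  _  = refl

  on-S-inverse : (h k : Fin n → Fin n) → (∀ {y} → S y → S (k y)) → (∀ y → h (k y) ≡ y) →
                 ∀ y → on-S h (on-S k y) ≡ y
  on-S-inverse h k k-closed hk y with S? y
  ... | yes Sy = trans (on-S-inside h (k-closed Sy)) (hk y)
  ... | no ¬Sy = on-S-outside h ¬Sy

  restrict : Permutation′ n
  restrict = permutation (on-S (π ⟨$⟩ʳ_)) (on-S (π ⟨$⟩ˡ_))
    (on-S-inverse _ _ π⁻¹-closed (λ _ → inverseʳ π))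
    (on-S-inverse _ _ π-closed (λ _ → inverseˡ π))

  restrict≤c : restrict ≤c π
  restrict≤c x moved k = iter-agree _ _ (λ Sy → subst S (sym (on-S-inside _ Sy)) (π-closed Sy))
                                        (on-S-inside _) Sx k
    where
    Sx : S x
    Sx = decidable-stable (S? x) (moved ∘ on-S-outside _)

-- Separating arcs

SeparatingArc : Permutation′ n → Permutation′ n → Fin n → Set
SeparatingArc σ τ a = σ ⟨$⟩ʳ a ≢ a × τ ⟨$⟩ʳ (σ ⟨$⟩ʳ a) ≢ a
                    × (τ ⟨$⟩ʳ a ≡ σ ⟨$⟩ʳ a → σ ⟨$⟩ʳ (σ ⟨$⟩ʳ a) ≡ a)

separatingArc? : (σ τ : Permutation′ n) → Decidable (SeparatingArc σ τ)
separatingArc? σ τ a = ¬? (σ ⟨$⟩ʳ a ≟ a) ×-dec ¬? (τ ⟨$⟩ʳ (σ ⟨$⟩ʳ a) ≟ a)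
                     ×-dec (τ ⟨$⟩ʳ a ≟ σ ⟨$⟩ʳ a →-dec σ ⟨$⟩ʳ (σ ⟨$⟩ʳ a) ≟ a)

module Unseparated (σ τ : Permutation′ n) (unseparated : ∀ a → ¬ SeparatingArc σ τ a) where

  σ⁺ σ⁻ τ⁺ τ⁻ : Fin n → Fin n
  σ⁺ = σ ⟨$⟩ʳ_
  σ⁻ = σ ⟨$⟩ˡ_
  τ⁺ = τ ⟨$⟩ʳ_
  τ⁻ = τ ⟨$⟩ˡ_

  Moved Forward Backward : Fin n → Set
  Moved y    = σ⁺ y ≢ y
  Forward y  = Moved y × τ⁺ y ≡ σ⁺ y × σ⁺ (σ⁺ y) ≢ y
  Backward y = Moved y × τ⁺ (σ⁺ y) ≡ y

  forward-or-backward : ∀ {y} → Moved y → Forward y ⊎ Backward y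
  forward-or-backward {y} moved with τ⁺ (σ⁺ y) ≟ y
  ... | yes back = inj₂ (moved , back)
  ... | no ¬back with τ⁺ y ≟ σ⁺ y
  ...   | no ¬follow = contradiction (moved , ¬back , λ follow → contradiction follow ¬follow) (unseparated y)
  ...   | yes follow with σ⁺ (σ⁺ y) ≟ y
  ...     | yes twoCycle = contradiction (moved , ¬back , λ _ → twoCycle) (unseparated y)
  ...     | no ¬twoCycle = inj₁ (moved , follow , ¬twoCycle)

  moved-σ⁺ : ∀ {y} → Moved y → Moved (σ⁺ y)
  moved-σ⁺ moved = moved ∘ ⟨$⟩ʳ-injective σ

  moved-σ⁻ : ∀ {y} → Moved y → Moved (σ⁻ y)
  moved-σ⁻ {y} moved fixed = moved (trans (cong σ⁺ y≡σ⁻y) (inverseʳ σ))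
    where
    y≡σ⁻y : y ≡ σ⁻ y
    y≡σ⁻y = trans (sym (inverseʳ σ)) fixed

  forward-σ : ∀ {y} → Forward y → Forward (σ⁺ y)
  forward-σ (moved , follow , ¬twoCycle) with forward-or-backward (moved-σ⁺ moved)
  ... | inj₁ fw            = fw
  ... | inj₂ (_ , back)    = contradiction (⟨$⟩ʳ-injective τ (trans back (sym follow))) ¬twoCycle

  backward-σ : ∀ {y} → Backward y → Backward (σ⁺ y)
  backward-σ (moved , back) with forward-or-backward (moved-σ⁺ moved)
  ... | inj₂ bw                        = bw
  ... | inj₁ (_ , follow , ¬twoCycle) = contradiction (cong σ⁺ (trans (sym follow) back)) ¬twoCycle

  backward-σ⁻ : ∀ {y} → Backward y → Backward (σ⁻ y)
  backward-σ⁻ {y} (moved , back) with forward-or-backward (moved-σ⁻ moved)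
  ... | inj₂ bw                        = bw
  ... | inj₁ (_ , follow , ¬twoCycle) = contradiction (trans (cong σ⁺ (inverseʳ σ)) σ⁺y≡σ⁻y) ¬twoCycle
    where
    σ⁺y≡σ⁻y : σ⁺ y ≡ σ⁻ y
    σ⁺y≡σ⁻y = ⟨$⟩ʳ-injective τ (trans back (sym (trans follow (inverseʳ σ))))

  τ⁺-backward : ∀ {y} → Backward y → τ⁺ y ≡ σ⁻ y
  τ⁺-backward {y} bw = trans (cong τ⁺ (sym (inverseʳ σ))) (proj₂ (backward-σ⁻ bw))

  τ⁻-backward : ∀ {y} → Backward y → τ⁻ y ≡ σ⁺ y
  τ⁻-backward (_ , back) = trans (cong τ⁻ (sym back)) (inverseˡ τ)

  moved-τ⁺ : ∀ {y} → Moved y → Moved (τ⁺ y)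
  moved-τ⁺ moved with forward-or-backward moved
  ... | inj₁ (_ , follow , _) = subst Moved (sym follow) (moved-σ⁺ moved)
  ... | inj₂ bw               = subst Moved (sym (τ⁺-backward bw)) (moved-σ⁻ moved)

  moved-τ⁻ : ∀ {y} → Moved y → Moved (τ⁻ y)
  moved-τ⁻ {y} moved with forward-or-backward (moved-σ⁻ moved)
  ... | inj₁ (moved′ , follow , _) = subst Moved (sym τ⁻y≡σ⁻y) moved′
    where
    τ⁻y≡σ⁻y : τ⁻ y ≡ σ⁻ y
    τ⁻y≡σ⁻y = trans (cong τ⁻ (sym (trans follow (inverseʳ σ)))) (inverseˡ τ)
  ... | inj₂ bw = subst Moved (sym (τ⁻-backward bw′)) (moved-σ⁺ moved)
    where
    bw′ : Backward y
    bw′ = subst Backward (inverseʳ σ) (backward-σ bw)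

  open Restriction τ (λ y → ¬? (σ⁺ y ≟ y)) moved-τ⁺ moved-τ⁻

  FixedOrForward : Fin n → Set
  FixedOrForward y = σ⁺ y ≡ y ⊎ Forward y

  σ-orbit≡restrict-orbit : ∀ {x} → FixedOrForward x → ∀ k → cycleSeq σ x k ≡ cycleSeq restrict x k
  σ-orbit≡restrict-orbit = iter-agree _ _ (Sum.map (cong σ⁺) forward-σ)
    [ (λ fixed → trans fixed (sym (on-S-outside τ⁺ (λ moved → moved fixed))))
    , (λ (moved , follow , _) → trans (sym follow) (sym (on-S-inside τ⁺ moved))) ]

  σ-orbit≡restrict⁻¹-orbit : ∀ {x} → Backward x → ∀ k → cycleSeq σ x k ≡ invCycleSeq restrict x k
  σ-orbit≡restrict⁻¹-orbit = iter-agree _ _ backward-σ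
    (λ bw → trans (sym (τ⁻-backward bw)) (sym (on-S-inside τ⁻ (proj₁ bw))))

  σ⁻¹-orbit≡restrict-orbit : ∀ {x} → Backward x → ∀ k → invCycleSeq σ x k ≡ cycleSeq restrict x k
  σ⁻¹-orbit≡restrict-orbit = iter-agree _ _ backward-σ⁻
    (λ bw → trans (sym (τ⁺-backward bw)) (sym (on-S-inside τ⁺ (proj₁ bw))))

  classify : ∀ x → FixedOrForward x ⊎ Backward x
  classify x with σ⁺ x ≟ x
  ... | yes fixed = inj₁ (inj₁ fixed)
  ... | no moved  = Sum.map₁ inj₂ (forward-or-backward moved)

  restrict∼σ : restrict ∼c σ
  restrict∼σ = (λ x → Sum.map (λ c k → sym (σ-orbit≡restrict-orbit c k))
                              (λ bw k → sym (σ⁻¹-orbit≡restrict-orbit bw k)) (classify x))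
             , (λ x → Sum.map σ-orbit≡restrict-orbit σ-orbit≡restrict⁻¹-orbit (classify x))

  σ≤[c]τ : σ ≤[c] τ
  σ≤[c]τ = restrict , τ , restrict∼σ , ∼c-refl τ , restrict≤c

¬≤[c]⇒separatingArc : (σ τ : Permutation′ n) → ¬ σ ≤[c] τ → ∃ (SeparatingArc σ τ)
¬≤[c]⇒separatingArc σ τ σ⋠τ = decidable-stable (any? (separatingArc? σ τ))
  (λ ¬arc → σ⋠τ (Unseparated.σ≤[c]τ σ τ (λ a arc → ¬arc (a , arc))))

*-nonNeg : ∀ {p q} → 0ℚ ≤ p → 0ℚ ≤ q → 0ℚ ≤ p * q
*-nonNeg {p} {q} 0≤p 0≤q =
  nonNegative⁻¹ _ {{nonNeg*nonNeg⇒nonNeg p {{nonNegative 0≤p}} q {{nonNegative 0≤q}}}}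

*-pos : ∀ {p q} → 0ℚ < p → 0ℚ < q → 0ℚ < p * q
*-pos {p} {q} 0<p 0<q = positive⁻¹ _ {{pos*pos⇒pos p {{positive 0<p}} q {{positive 0<q}}}}

0≤1 : 0ℚ ≤ 1ℚ
0≤1 = from-yes (0ℚ ≤? 1ℚ)

1≤⇒0< : ∀ {p} → 1ℚ ≤ p → 0ℚ < p
1≤⇒0< = <-≤-trans (from-yes (0ℚ <? 1ℚ))

*-mono-≤-nonNeg : ∀ {p q r s} → 0ℚ ≤ p → 0ℚ ≤ r → p ≤ q → r ≤ s → p * r ≤ q * s
*-mono-≤-nonNeg {p} {q} {r} {s} 0≤p 0≤r p≤q r≤s =
  ≤-trans (*-monoʳ-≤-nonNeg r {{nonNegative 0≤r}} p≤q)
          (*-monoˡ-≤-nonNeg q {{nonNegative (≤-trans 0≤p p≤q)}} r≤s)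

square-pos : ∀ {p} → p ≢ 0ℚ → 0ℚ < p * p
square-pos {p} p≢0 with <-cmp p 0ℚ
... | tri< p<0 _ _ = positive⁻¹ _ {{neg*neg⇒pos p {{negative p<0}} p {{negative p<0}}}}
... | tri≈ _ p≡0 _ = contradiction p≡0 p≢0
... | tri> _ _ p>0 = *-pos p>0 p>0

square-nonNeg : ∀ p → 0ℚ ≤ p * p
square-nonNeg p with p ℚ.≟ 0ℚ
... | yes refl = ≤-refl
... | no p≢0   = <⇒≤ (square-pos p≢0)

sumFin≡sum : (f : Fin n → ℚ) → sumFin f ≡ sum f
sumFin≡sum {zero}  f = refl
sumFin≡sum {suc n} f = cong (f zero +_) (sumFin≡sum (f ∘ suc))

sum-nonNeg : (f : Fin n → ℚ) → (∀ i → 0ℚ ≤ f i) → 0ℚ ≤ sum f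
sum-nonNeg {zero}  f 0≤f = ≤-refl
sum-nonNeg {suc n} f 0≤f = +-mono-≤ (0≤f zero) (sum-nonNeg (f ∘ suc) (0≤f ∘ suc))

sum-pos : (f : Fin n → ℚ) → (∀ i → 0ℚ ≤ f i) → ∀ i → 0ℚ < f i → 0ℚ < sum f
sum-pos f 0≤f zero    0<fi = +-mono-<-≤ 0<fi (sum-nonNeg (f ∘ suc) (0≤f ∘ suc))
sum-pos f 0≤f (suc i) 0<fi = +-mono-≤-< (0≤f zero) (sum-pos (f ∘ suc) (0≤f ∘ suc) i 0<fi)

prod-pos : (f : Fin n → ℚ) → (∀ i → 0ℚ < f i) → 0ℚ < prodFin f
prod-pos {zero}  f 0<f = from-yes (0ℚ <? 1ℚ)
prod-pos {suc n} f 0<f = *-pos (0<f zero) (prod-pos (f ∘ suc) (0<f ∘ suc))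

prod-nonNeg : (f : Fin n → ℚ) → (∀ i → 0ℚ ≤ f i) → 0ℚ ≤ prodFin f
prod-nonNeg {zero}  f 0≤f = 0≤1
prod-nonNeg {suc n} f 0≤f = *-nonNeg (0≤f zero) (prod-nonNeg (f ∘ suc) (0≤f ∘ suc))

prod-mono : (f g : Fin n → ℚ) → (∀ i → 0ℚ ≤ f i) → (∀ i → f i ≤ g i) → prodFin f ≤ prodFin g
prod-mono {zero}  f g 0≤f f≤g = ≤-refl
prod-mono {suc n} f g 0≤f f≤g = *-mono-≤-nonNeg (0≤f zero) (prod-nonNeg (f ∘ suc) (0≤f ∘ suc))
  (f≤g zero) (prod-mono (f ∘ suc) (g ∘ suc) (0≤f ∘ suc) (f≤g ∘ suc))

1≤prod : (f : Fin n → ℚ) → (∀ i → 1ℚ ≤ f i) → 1ℚ ≤ prodFin f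
1≤prod {zero}  f 1≤f = ≤-refl
1≤prod {suc n} f 1≤f = *-mono-≤-nonNeg 0≤1 0≤1
  (1≤f zero) (1≤prod (f ∘ suc) (1≤f ∘ suc))

_[_]≔1 : (Fin n → ℚ) → Fin n → Fin n → ℚ
f [ a ]≔1 = updateAt f a (const 1ℚ)

prod-extract : (f : Fin n → ℚ) (a : Fin n) → prodFin f ≡ f a * prodFin (f [ a ]≔1)
prod-extract f zero    = cong (f zero *_) (sym (*-identityˡ _))
prod-extract f (suc a) = trans (cong (f zero *_) (prod-extract (f ∘ suc) a))
                               (x∙yz≈y∙xz (f zero) (f (suc a)) _)

module _ {a b : Fin n} (a≢b : a ≢ b) where

  prod-extract₂ : (f : Fin n → ℚ) → prodFin f ≡ f a * (f b * prodFin (f [ a ]≔1 [ b ]≔1))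
  prod-extract₂ f = trans (prod-extract f a) (cong (f a *_)
    (trans (prod-extract (f [ a ]≔1) b)
           (cong (_* prodFin (f [ a ]≔1 [ b ]≔1)) (updateAt-minimal b a f (a≢b ∘ sym)))))

  ≔1-preserves : {P : ℚ → Set} (f : Fin n → ℚ) → P 1ℚ → (∀ k → k ≢ a → k ≢ b → P (f k)) →
                 ∀ k → P ((f [ a ]≔1 [ b ]≔1) k)
  ≔1-preserves {P} f P1 Pf k with k ≟ b
  ... | yes refl = subst P (sym (updateAt-updates b (f [ a ]≔1))) P1
  ... | no k≢b with k ≟ a
  ...   | yes refl = subst P (sym (trans (updateAt-minimal a b (f [ a ]≔1) k≢b) (updateAt-updates a f))) P1
  ...   | no k≢a   = subst P (sym (trans (updateAt-minimal k b (f [ a ]≔1) k≢b) (updateAt-minimal k a f k≢a))) (Pf k k≢a k≢b)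

  prod-≤-extract₂ : (f : Fin n → ℚ) {c : ℚ} → 1ℚ ≤ c → (∀ k → 0ℚ ≤ f k) →
                    (∀ k → k ≢ a → k ≢ b → f k ≤ c) → prodFin f ≤ f a * (f b * prodFin {n} (λ _ → c))
  prod-≤-extract₂ f {c} 1≤c 0≤f f≤c = begin
    prodFin f                                   ≡⟨ prod-extract₂ f ⟩
    f a * (f b * prodFin (f [ a ]≔1 [ b ]≔1))  ≤⟨ *-monoˡ-≤-nonNeg (f a) {{nonNegative (0≤f a)}}
                                                    (*-monoˡ-≤-nonNeg (f b) {{nonNegative (0≤f b)}} rest≤cⁿ) ⟩
    f a * (f b * prodFin {n} (λ _ → c))         ∎
    where
    open ≤-Reasoning
    rest≤cⁿ : prodFin (f [ a ]≔1 [ b ]≔1) ≤ prodFin {n} (λ _ → c)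
    rest≤cⁿ = prod-mono _ _
      (≔1-preserves {P = 0ℚ ≤_} f 0≤1 (λ k _ _ → 0≤f k))
      (≔1-preserves {P = _≤ c} f 1≤c f≤c)

  prod-≥-extract₂ : (f : Fin n → ℚ) → (∀ k → 0ℚ ≤ f k) →
                    (∀ k → k ≢ a → k ≢ b → 1ℚ ≤ f k) → f a * f b ≤ prodFin f
  prod-≥-extract₂ f 0≤f 1≤f = begin
    f a * f b                                    ≡⟨ cong (f a *_) (*-identityʳ (f b)) ⟨
    f a * (f b * 1ℚ)                             ≤⟨ *-monoˡ-≤-nonNeg (f a) {{nonNegative (0≤f a)}}
                                                     (*-monoˡ-≤-nonNeg (f b) {{nonNegative (0≤f b)}}
                                                       (1≤prod _ (≔1-preserves {P = 1ℚ ≤_} f ≤-refl 1≤f))) ⟩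
    f a * (f b * prodFin (f [ a ]≔1 [ b ]≔1))   ≡⟨ prod-extract₂ f ⟨
    prodFin f                                    ∎
    where open ≤-Reasoning

-- Positive definite matrices

2ℚ : ℚ
2ℚ = 1ℚ + 1ℚ

δ : Fin n → Fin n → ℚ
δ i j = if does (i ≟ j) then 1ℚ else 0ℚ

δ-diag : (i : Fin n) → δ i i ≡ 1ℚ
δ-diag i = cong (λ β → if β then 1ℚ else 0ℚ) (dec-true (i ≟ i) refl)

δ-off : {i j : Fin n} → i ≢ j → δ i j ≡ 0ℚ
δ-off {i = i} {j} i≢j = cong (λ β → if β then 1ℚ else 0ℚ) (dec-false (i ≟ j) i≢j)

δ-sym : (i j : Fin n) → δ i j ≡ δ j i
δ-sym i j with i ≟ j
... | yes refl = sym (δ-diag i)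
... | no i≢j   = sym (δ-off (i≢j ∘ sym))

1≤δ+1≤2 : (i j : Fin n) → 1ℚ ≤ δ i j + 1ℚ × δ i j + 1ℚ ≤ 2ℚ
1≤δ+1≤2 i j with i ≟ j
... | yes _ = from-yes (1ℚ ≤? 2ℚ) , ≤-refl
... | no  _ = ≤-refl , from-yes (1ℚ ≤? 2ℚ)

sum-δ : (i : Fin n) (f : Fin n → ℚ) → ∑[ j < n ] (δ i j * f j) ≡ f i
sum-δ {suc n} zero f = begin
  1ℚ * f zero + ∑[ j < n ] (0ℚ * f (suc j))  ≡⟨ cong₂ _+_ (*-identityˡ (f zero)) (sum-cong-≗ (*-zeroˡ ∘ f ∘ suc)) ⟩
  f zero + ∑[ j < n ] 0ℚ                    ≡⟨ cong (f zero +_) (sum-replicate-zero n) ⟩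
  f zero + 0ℚ                               ≡⟨ +-identityʳ (f zero) ⟩
  f zero                                    ∎
  where open ≡-Reasoning
sum-δ {suc n} (suc i) f = trans (cong₂ _+_ (*-zeroˡ (f zero)) (sum-δ i (f ∘ suc))) (+-identityˡ (f (suc i)))

𝕀 : Matrix n
𝕀 = δ

infixl 6 _⊕_
_⊕_ : Matrix n → Matrix n → Matrix n
(A ⊕ B) i j = A i j + B i j

rankOne : ℚ → (Fin n → ℚ) → Matrix n
rankOne c u i j = c * (u i * u j)

PositiveSemidefinite : Matrix n → Set
PositiveSemidefinite A = Symmetric A × (∀ z → 0ℚ ≤ quadForm A z)

quadForm≡∑∑ : (A : Matrix n) (z : Fin n → ℚ) → quadForm A z ≡ ∑[ i < n ] ∑[ j < n ] (z i * A i j * z j)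
quadForm≡∑∑ A z = trans (sumFin≡sum (λ i → sumFin (λ j → z i * A i j * z j)))
                          (sum-cong-≗ (λ i → sumFin≡sum (λ j → z i * A i j * z j)))

quadForm-⊕ : (A B : Matrix n) (z : Fin n → ℚ) → quadForm (A ⊕ B) z ≡ quadForm A z + quadForm B z
quadForm-⊕ {n} A B z = begin
  quadForm (A ⊕ B) z
    ≡⟨ quadForm≡∑∑ (A ⊕ B) z ⟩
  ∑[ i < n ] ∑[ j < n ] (z i * (A i j + B i j) * z j)
    ≡⟨ sum-cong-≗ (λ i → trans (sum-cong-≗ (λ j → distrib (z i) (z j)))
                                (∑-distrib-+ (λ j → z i * A i j * z j) (λ j → z i * B i j * z j))) ⟩
  ∑[ i < n ] (∑[ j < n ] (z i * A i j * z j) + ∑[ j < n ] (z i * B i j * z j))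
    ≡⟨ ∑-distrib-+ (λ i → ∑[ j < n ] (z i * A i j * z j)) (λ i → ∑[ j < n ] (z i * B i j * z j)) ⟩
  ∑[ i < n ] ∑[ j < n ] (z i * A i j * z j) + ∑[ i < n ] ∑[ j < n ] (z i * B i j * z j)
    ≡⟨ cong₂ _+_ (quadForm≡∑∑ A z) (quadForm≡∑∑ B z) ⟨
  quadForm A z + quadForm B z
    ∎
  where
  open ≡-Reasoning
  distrib : ∀ x y {p q} → x * (p + q) * y ≡ x * p * y + x * q * y
  distrib x y {p} {q} = trans (cong (_* y) (*-distribˡ-+ x p q)) (*-distribʳ-+ y (x * p) (x * q))

quadForm-𝕀 : (z : Fin n → ℚ) → quadForm 𝕀 z ≡ ∑[ i < n ] (z i * z i)
quadForm-𝕀 {n} z = begin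
  quadForm 𝕀 z                                 ≡⟨ quadForm≡∑∑ 𝕀 z ⟩
  ∑[ i < n ] ∑[ j < n ] (z i * δ i j * z j)    ≡⟨ sum-cong-≗ (λ i → sum-cong-≗ (λ j → *-assoc (z i) (δ i j) (z j))) ⟩
  ∑[ i < n ] ∑[ j < n ] (z i * (δ i j * z j))  ≡⟨ sum-cong-≗ (λ i → *-distribˡ-sum (z i) (λ j → δ i j * z j)) ⟨
  ∑[ i < n ] (z i * ∑[ j < n ] (δ i j * z j))  ≡⟨ sum-cong-≗ (λ i → cong (z i *_) (sum-δ i z)) ⟩
  ∑[ i < n ] (z i * z i)                       ∎
  where open ≡-Reasoning

quadForm-rankOne : (c : ℚ) (u z : Fin n → ℚ) →
                   quadForm (rankOne c u) z ≡ c * ∑[ i < n ] (u i * z i) * ∑[ i < n ] (u i * z i)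
quadForm-rankOne {n} c u z = begin
  quadForm (rankOne c u) z
    ≡⟨ quadForm≡∑∑ (rankOne c u) z ⟩
  ∑[ i < n ] ∑[ j < n ] (z i * (c * (u i * u j)) * z j)
    ≡⟨ sum-cong-≗ (λ i → sum-cong-≗ (λ j → regroup (z i) (z j) (u i) (u j))) ⟩
  ∑[ i < n ] ∑[ j < n ] (c * (u i * z i) * (u j * z j))
    ≡⟨ sum-cong-≗ (λ i → *-distribˡ-sum (c * (u i * z i)) (λ j → u j * z j)) ⟨
  ∑[ i < n ] (c * (u i * z i) * t)
    ≡⟨ *-distribʳ-sum t (λ i → c * (u i * z i)) ⟨
  ∑[ i < n ] (c * (u i * z i)) * t
    ≡⟨ cong (_* t) (*-distribˡ-sum c (λ i → u i * z i)) ⟨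
  c * t * t
    ∎
  where
  open ≡-Reasoning
  open +-*-Solver
  t : ℚ
  t = ∑[ i < n ] (u i * z i)
  regroup : ∀ zi zj ui uj → zi * (c * (ui * uj)) * zj ≡ c * (ui * zi) * (uj * zj)
  regroup = solve 5 (λ c zi zj ui uj → zi :* (c :* (ui :* uj)) :* zj := c :* (ui :* zi) :* (uj :* zj)) refl c

𝕀-positiveDefinite : PositiveDefinite (𝕀 {n})
𝕀-positiveDefinite = δ-sym , λ z (i , zi≢0) →
  subst (0ℚ <_) (sym (quadForm-𝕀 z)) (sum-pos _ (square-nonNeg ∘ z) i (square-pos zi≢0))

rankOne-positiveSemidefinite : ∀ {c} → 0ℚ ≤ c → (u : Fin n → ℚ) → PositiveSemidefinite (rankOne c u)
rankOne-positiveSemidefinite {n} {c} 0≤c u =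
  (λ i j → cong (c *_) (*-comm (u i) (u j))) ,
  λ z → let t = ∑[ i < n ] (u i * z i) in
    subst (0ℚ ≤_) (trans (sym (*-assoc c t t)) (sym (quadForm-rankOne c u z))) (*-nonNeg 0≤c (square-nonNeg t))

⊕-positiveDefinite : {A B : Matrix n} → PositiveDefinite A → PositiveSemidefinite B → PositiveDefinite (A ⊕ B)
⊕-positiveDefinite {A = A} {B} (A-sym , A-pos) (B-sym , B-nonNeg) =
  (λ i j → cong₂ _+_ (A-sym i j) (B-sym i j)) ,
  λ z z≢0 → subst (0ℚ <_) (sym (quadForm-⊕ A B z)) (+-mono-<-≤ (A-pos z z≢0) (B-nonNeg z))

-- The separating matrix

module SeparatingMatrix {a b : Fin n} (a≢b : a ≢ b) where

  P : ℚ
  P = prodFin {n} (λ _ → 2ℚ)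

  1≤P : 1ℚ ≤ P
  1≤P = 1≤prod {n} _ (λ _ → from-yes (1ℚ ≤? 2ℚ))

  instance
    P-positive : Positive P
    P-positive = positive (1≤⇒0< 1≤P)

    P-nonZero : NonZero P
    P-nonZero = pos⇒nonZero P

  d : ℚ
  d = ½ * 1/ P

  d*P≡½ : d * P ≡ ½
  d*P≡½ = trans (*-assoc ½ (1/ P) P) (trans (cong (½ *_) (*-inverseˡ P)) (*-identityʳ ½))

  0<d : 0ℚ < d
  0<d = *-pos (from-yes (0ℚ <? ½)) (positive⁻¹ (1/ P) {{1/pos⇒pos P}})

  d≤1 : d ≤ 1ℚ
  d≤1 = begin
    d       ≡⟨ *-identityʳ d ⟨
    d * 1ℚ  ≤⟨ *-monoˡ-≤-nonNeg d {{nonNegative (<⇒≤ 0<d)}} 1≤P ⟩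
    d * P   ≡⟨ d*P≡½ ⟩
    ½       ≤⟨ from-yes (½ ≤? 1ℚ) ⟩
    1ℚ      ∎
    where open ≤-Reasoning

  ε : ℚ
  ε = 1ℚ - d

  0≤ε : 0ℚ ≤ ε
  0≤ε = +-monoʳ-≤ 1ℚ (neg-antimono-≤ d≤1)

  w : Fin n → ℚ
  w k = δ a k - δ b k

  M : Matrix n
  M = 𝕀 ⊕ rankOne 1ℚ (λ _ → 1ℚ) ⊕ rankOne ε w

  M-positiveDefinite : PositiveDefinite M
  M-positiveDefinite = ⊕-positiveDefinite
    (⊕-positiveDefinite 𝕀-positiveDefinite (rankOne-positiveSemidefinite 0≤1 (λ _ → 1ℚ)))
    (rankOne-positiveSemidefinite 0≤ε w)

  w-a : w a ≡ 1ℚ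
  w-a = cong₂ _-_ (δ-diag a) (δ-off (a≢b ∘ sym))

  w-b : w b ≡ - 1ℚ
  w-b = cong₂ _-_ (δ-off a≢b) (δ-diag b)

  w-outside : ∀ {k} → k ≢ a → k ≢ b → w k ≡ 0ℚ
  w-outside k≢a k≢b = cong₂ _-_ (δ-off (k≢a ∘ sym)) (δ-off (k≢b ∘ sym))

  -- The middle summand rankOne 1ℚ (λ _ → 1ℚ) i j computes to 1ℚ.
  M-entry : ∀ i j {x} → w i * w j ≡ x → M i j ≡ (δ i j + 1ℚ) + ε * x
  M-entry i j = cong (λ x → (δ i j + 1ℚ) + ε * x)

  M-entry-0 : ∀ i j → w i * w j ≡ 0ℚ → M i j ≡ δ i j + 1ℚ
  M-entry-0 i j ww≡0 = trans (M-entry i j ww≡0) (trans (cong (δ i j + 1ℚ +_) (*-zeroʳ ε)) (+-identityʳ _))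

  M-row-outside : ∀ {k} j → k ≢ a → k ≢ b → M k j ≡ δ k j + 1ℚ
  M-row-outside {k} j k≢a k≢b = M-entry-0 k j (trans (cong (_* w j) (w-outside k≢a k≢b)) (*-zeroˡ (w j)))

  M-col-outside : ∀ i {k} → k ≢ a → k ≢ b → M i k ≡ δ i k + 1ℚ
  M-col-outside i {k} k≢a k≢b = M-entry-0 i k (trans (cong (w i *_) (w-outside k≢a k≢b)) (*-zeroʳ (w i)))

  M-off-diagonal : ∀ {i j} → i ≢ j → w i * w j ≡ - 1ℚ → M i j ≡ d
  M-off-diagonal {i} {j} i≢j ww≡-1 = begin
    M i j                          ≡⟨ M-entry i j ww≡-1 ⟩
    (δ i j + 1ℚ) + ε * - 1ℚ       ≡⟨ cong (λ x → (x + 1ℚ) + ε * - 1ℚ) (δ-off i≢j) ⟩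
    1ℚ + (1ℚ - d) * - 1ℚ          ≡⟨ solve 1 (λ d → con 1ℚ :+ (con 1ℚ :- d) :* con (- 1ℚ) := d) refl d ⟩
    d                              ∎
    where
    open ≡-Reasoning
    open +-*-Solver

  M-ab : M a b ≡ d
  M-ab = M-off-diagonal a≢b (cong₂ _*_ w-a w-b)

  M-ba : M b a ≡ d
  M-ba = M-off-diagonal (a≢b ∘ sym) (cong₂ _*_ w-b w-a)

  1≤M-diagonal : ∀ i → w i * w i ≡ 1ℚ → 1ℚ ≤ M i i
  1≤M-diagonal i ww≡1 = subst (1ℚ ≤_)
    (sym (trans (M-entry i i ww≡1) (cong (λ x → (x + 1ℚ) + ε * 1ℚ) (δ-diag i))))
    (+-mono-≤ (from-yes (1ℚ ≤? 2ℚ)) (*-nonNeg 0≤ε 0≤1))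

  data Position : Fin n → Set where
    at-a    : Position a
    at-b    : Position b
    outside : ∀ {k} → k ≢ a → k ≢ b → Position k

  position : ∀ k → Position k
  position k with k ≟ a | k ≟ b
  ... | yes refl | _        = at-a
  ... | no _     | yes refl = at-b
  ... | no k≢a   | no k≢b   = outside k≢a k≢b

  M-row-outside-bounds : ∀ {k} j → k ≢ a → k ≢ b → 1ℚ ≤ M k j × M k j ≤ 2ℚ
  M-row-outside-bounds {k} j k≢a k≢b =
    subst (λ x → 1ℚ ≤ x × x ≤ 2ℚ) (sym (M-row-outside j k≢a k≢b)) (1≤δ+1≤2 k j)

  1≤M-row-a : ∀ {j} → j ≢ b → 1ℚ ≤ M a j
  1≤M-row-a {j} j≢b with position j
  ... | at-a            = 1≤M-diagonal a (cong₂ _*_ w-a w-a)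
  ... | at-b            = contradiction refl j≢b
  ... | outside j≢a _   = subst (1ℚ ≤_) (sym (M-col-outside a j≢a j≢b)) (proj₁ (1≤δ+1≤2 a j))

  1≤M-row-b : ∀ {j} → j ≢ a → 1ℚ ≤ M b j
  1≤M-row-b {j} j≢a with position j
  ... | at-a            = contradiction refl j≢a
  ... | at-b            = 1≤M-diagonal b (cong₂ _*_ w-b w-b)
  ... | outside _ j≢b   = subst (1ℚ ≤_) (sym (M-col-outside b j≢a j≢b)) (proj₁ (1≤δ+1≤2 b j))

  M-row-b≤1 : ∀ {j} → j ≢ b → M b j ≤ 1ℚ
  M-row-b≤1 {j} j≢b with position j
  ... | at-a            = subst (_≤ 1ℚ) (sym M-ba) d≤1
  ... | at-b            = contradiction refl j≢b
  ... | outside j≢a _   = ≤-reflexive (trans (M-col-outside b j≢a j≢b) (cong (_+ 1ℚ) (δ-off (j≢b ∘ sym))))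

  0<M : ∀ i j → 0ℚ < M i j
  0<M i j with position i
  ... | outside i≢a i≢b = 1≤⇒0< (proj₁ (M-row-outside-bounds j i≢a i≢b))
  0<M _ j | at-a with j ≟ b
  ...   | yes refl = subst (0ℚ <_) (sym M-ab) 0<d
  ...   | no j≢b   = 1≤⇒0< (1≤M-row-a j≢b)
  0<M _ j | at-b with j ≟ a
  ...   | yes refl = subst (0ℚ <_) (sym M-ba) 0<d
  ...   | no j≢a   = 1≤⇒0< (1≤M-row-b j≢a)

  permProd-≤ : (σ : Permutation′ n) → permProd M σ ≤ M a (σ ⟨$⟩ʳ a) * (M b (σ ⟨$⟩ʳ b) * P)
  permProd-≤ σ = prod-≤-extract₂ a≢b _ (from-yes (1ℚ ≤? 2ℚ)) (λ k → <⇒≤ (0<M k _))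
    (λ k k≢a k≢b → proj₂ (M-row-outside-bounds _ k≢a k≢b))

  permProd-≥ : (σ : Permutation′ n) → M a (σ ⟨$⟩ʳ a) * M b (σ ⟨$⟩ʳ b) ≤ permProd M σ
  permProd-≥ σ = prod-≥-extract₂ a≢b _ (λ k → <⇒≤ (0<M k _))
    (λ k k≢a k≢b → proj₁ (M-row-outside-bounds _ k≢a k≢b))

  module _ (σ τ : Permutation′ n) (σa≡b : σ ⟨$⟩ʳ a ≡ b) (τb≢a : τ ⟨$⟩ʳ b ≢ a)
           (twoCycle : τ ⟨$⟩ʳ a ≡ b → σ ⟨$⟩ʳ b ≡ a) where

    Maσa≡d : M a (σ ⟨$⟩ʳ a) ≡ d
    Maσa≡d = trans (cong (M a) σa≡b) M-ab

    σb≢b : σ ⟨$⟩ʳ b ≢ b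
    σb≢b σb≡b = a≢b (⟨$⟩ʳ-injective σ (trans σa≡b (sym σb≡b)))

    permProd-< : permProd M σ < permProd M τ
    permProd-< with τ ⟨$⟩ʳ a ≟ b
    ... | no τa≢b = begin-strict
      permProd M σ                            ≤⟨ permProd-≤ σ ⟩
      M a (σ ⟨$⟩ʳ a) * (M b (σ ⟨$⟩ʳ b) * P)   ≡⟨ cong (_* (M b (σ ⟨$⟩ʳ b) * P)) Maσa≡d ⟩
      d * (M b (σ ⟨$⟩ʳ b) * P)                ≤⟨ *-monoˡ-≤-nonNeg d {{nonNegative (<⇒≤ 0<d)}}
                                                   (*-monoʳ-≤-nonNeg P {{pos⇒nonNeg P}} (M-row-b≤1 σb≢b)) ⟩
      d * (1ℚ * P)                            ≡⟨ cong (d *_) (*-identityˡ P) ⟩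
      d * P                                   ≡⟨ d*P≡½ ⟩
      ½                                       <⟨ from-yes (½ <? 1ℚ) ⟩
      1ℚ * 1ℚ                                 ≤⟨ *-mono-≤-nonNeg 0≤1 0≤1 (1≤M-row-a τa≢b) (1≤M-row-b τb≢a) ⟩
      M a (τ ⟨$⟩ʳ a) * M b (τ ⟨$⟩ʳ b)         ≤⟨ permProd-≥ τ ⟩
      permProd M τ                            ∎
      where open ≤-Reasoning
    ... | yes τa≡b = begin-strict
      permProd M σ                            ≤⟨ permProd-≤ σ ⟩
      M a (σ ⟨$⟩ʳ a) * (M b (σ ⟨$⟩ʳ b) * P)   ≡⟨ cong₂ (λ x y → x * (y * P)) Maσa≡d (trans (cong (M b) (twoCycle τa≡b)) M-ba) ⟩
      d * (d * P)                             ≡⟨ cong (d *_) d*P≡½ ⟩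
      d * ½                                   <⟨ *-monoʳ-<-pos d {{positive 0<d}} (from-yes (½ <? 1ℚ)) ⟩
      d * 1ℚ                                  ≤⟨ *-mono-≤-nonNeg (<⇒≤ 0<d) 0≤1
                                                   (≤-reflexive (sym (trans (cong (M a) τa≡b) M-ab))) (1≤M-row-b τb≢a) ⟩
      M a (τ ⟨$⟩ʳ a) * M b (τ ⟨$⟩ʳ b)         ≤⟨ permProd-≥ τ ⟩
      permProd M τ                            ∎
      where open ≤-Reasoning

separatingMatrix : (σ τ : Permutation′ n) → ∃ (SeparatingArc σ τ) →
                   ∃ λ A → PositiveDefinite A × 0ℚ < permProd A σ × permProd A σ < permProd A τ
separatingMatrix σ τ (a , σa≢a , τσa≢a , twoCycle) =
  M , M-positiveDefinite , prod-pos _ (λ k → 0<M k _) , permProd-< σ τ refl τσa≢a twoCycle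
  where open SeparatingMatrix (σa≢a ∘ sym)

proposition4p10 : (n : ℕ) (σ τ : Permutation′ n) → Incomparable σ τ →
    (∃ λ A → PositiveDefinite A × 0ℚ < permProd A σ × permProd A σ < permProd A τ)
    × (∃ λ A' → PositiveDefinite A' × 0ℚ < permProd A' τ × permProd A' τ < permProd A' σ)
proposition4p10 n σ τ (τ⋠σ , σ⋠τ) =
  separatingMatrix σ τ (¬≤[c]⇒separatingArc σ τ σ⋠τ) ,
  separatingMatrix τ σ (¬≤[c]⇒separatingArc τ σ τ⋠σ)
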